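{- (CbN) In $(\Lambda,\to_\beta)$, $\to_{\ell\ell,\beta}$ is a normalizing strategy for $\to_\beta$. (CbV) In $(\Lambda,\to_{\beta_v})$, $\to_{\ell\ell,\beta_v}$ is a normalizing strategy for $\to_{\beta_v}$.
   Context: Pure $\lambda$-terms: $t ::= x\mid\lambda x.t\mid ts$ (set $\Lambda$); values are variables and abstractions; contexts $c ::= [\cdot]\mid tc\mid ct\mid\lambda x.c$. $\to_\beta$ and $\to_{\beta_v}$ are the contextual closures of $(\lambda x.t)s\mapsto_\beta t[s/x]$ and $(\lambda x.t)v\mapsto_{\beta_v}t[v/x]$ ($v$ value). CbN level: $\mathrm{lev}^n([\cdot])=0$, $\mathrm{lev}^n(\lambda x.c)=\mathrm{lev}^n(ct)=\mathrm{lev}^n(c)$, $\mathrm{lev}^n(tc)=\mathrm{lev}^n(c)+1$. CbV level: $\mathrm{lev}^v([\cdot])=0$, $\mathrm{lev}^v(\lambda x.c)=\mathrm{lev}^v(c)+1$, $\mathrm{lev}^v(ct)=\mathrm{lev}^v(c')$ if $c=\lambda x.c'$ and $\mathrm{lev}^v(c)$ otherwise, $\mathrm{lev}^v(tc)=\mathrm{lev}^v(c)$. The least level of $t$ is the infimum (in $\mathbb{N}\cup\{\infty\}$) of the levels of $c$ over decompositions $t=c[r]$ with $r$ a $\beta$-redex (CbN, using $\mathrm{lev}^n$) or a $\beta_v$-redex (CbV, using $\mathrm{lev}^v$); a step $c[r]\to c[r']$ is least-level ($\to_{\ell\ell,\beta}$, resp. $\to_{\ell\ell,\beta_v}$) if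 the level of $c$ equals the least level of $c[r]$. A strategy $\to_e\subseteq\to$ is normalizing for $\to$ if it has the same normal forms as $\to$ and, whenever $t\to^*u$ with $u$ $\to$-normal, every maximal $\to_e$-sequence from $t$ ends in a normal form. -}

module Defs where

open import Data.Nat using (ℕ; zero; suc; _≤_; _<?_)
open import Data.Product using (Σ; ∃; _×_; _,_)
open import Data.Empty using (⊥)
open import Relation.Nullary using (¬_; yes; no)
open import Relation.Binary.PropositionalEquality using (_≡_)
open import Relation.Binary.Construct.Closure.ReflexiveTransitive using (Star)

-- Pure λ-terms, with de Bruijn indices (terms up to α-equivalence).
data Term : Set where
  var : ℕ → Term
  lam : Term → Term
  app : Term → Term → Term

data Value : Term → Set where
  var : ∀ n → Value (var n)
  lam : ∀ t → Value (lam t)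

shift : ℕ → Term → Term
shift c (var n) with n <? c
... | yes _ = var n
... | no  _ = var (suc n)
shift c (lam t) = lam (shift (suc c) t)
shift c (app t s) = app (shift c t) (shift c s)

-- subst k s t : replace index k by s in t, decrementing indices above k
subst : ℕ → Term → Term → Term
subst k s (var n) with n <? k
... | yes _ = var n
... | no _ with n Data.Nat.≟ k
...   | yes _ = s
...   | no _ with n
...     | zero = var zero
...     | suc m = var m
subst k s (lam t) = lam (subst (suc k) (shift 0 s) t)
subst k s (app t u) = app (subst k s t) (subst k s u)

-- t[s/x] where x is the variable bound by the abstraction λx.t
_[_/0] : Term → Term → Term
t [ s /0] = subst 0 s t

data _↦β_ : Term → Term → Set where
  beta : ∀ t s → app (lam t) s ↦β (t [ s /0])

data _↦βv_ : Term → Term → Set where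
  betav : ∀ t v → Value v → app (lam t) v ↦βv (t [ v /0])

data Ctx : Set where
  hole : Ctx
  appR : Term → Ctx → Ctx
  appL : Ctx → Term → Ctx
  lamC : Ctx → Ctx

plug : Ctx → Term → Term
plug hole r = r
plug (appR t c) r = app t (plug c r)
plug (appL c t) r = app (plug c r) t
plug (lamC c) r = lam (plug c r)

levN : Ctx → ℕ
levN hole = 0
levN (lamC c) = levN c
levN (appL c t) = levN c
levN (appR t c) = suc (levN c)

levV : Ctx → ℕ
levV hole = 0
levV (lamC c) = suc (levV c)
levV (appL (lamC c') t) = levV c'
levV (appL c t) = levV c
levV (appR t c) = levV c

Rel : Set₁
Rel = Term → Term → Set

ctxClosure : Rel → Rel
ctxClosure root t u =
  Σ Ctx λ c → Σ Term λ r → Σ Term λ r' →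
    (t ≡ plug c r) × (u ≡ plug c r') × root r r'

_→β_ : Rel
_→β_ = ctxClosure _↦β_

_→βv_ : Rel
_→βv_ = ctxClosure _↦βv_

-- Least-level steps: c[r] → c[r'] where lev c equals the least level of
-- c[r], i.e. the infimum of lev c' over all redex decompositions c'[r'']
-- of c[r].  Since c itself is such a decomposition, the infimum is a
-- minimum and "lev c = least level" amounts to lev c ≤ lev c' for all of them.
leastLevel : Rel → (Ctx → ℕ) → Rel
leastLevel root lev t u =
  Σ Ctx λ c → Σ Term λ r → Σ Term λ r' →
    (t ≡ plug c r) × (u ≡ plug c r') × root r r' ×
    (∀ (c' : Ctx) (r₁ r₁' : Term) → t ≡ plug c' r₁ → root r₁ r₁' → lev c ≤ lev c')

_→llβ_ : Rel
_→llβ_ = leastLevel _↦β_ levN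

_→llβv_ : Rel
_→llβv_ = leastLevel _↦βv_ levV

Normal : Rel → Term → Set
Normal R t = ∀ u → ¬ R t u

InfiniteFrom : Rel → Term → Set
InfiniteFrom R t = Σ (ℕ → Term) λ f → (f 0 ≡ t) × (∀ n → R (f n) (f (suc n)))

-- e is a normalizing strategy for R.
-- "every maximal e-sequence from t ends in a normal form": a maximal
-- sequence is either infinite or finite ending in an e-normal form (which
-- is R-normal by the first clause), so this says there is no infinite
-- e-sequence from t.
record NormalizingStrategy (e R : Rel) : Set where
  field
    sub        : ∀ t u → e t u → R t u
    sameNF     : ∀ t → (Normal e t → Normal R t) × (Normal R t → Normal e t)
    normalizes : ∀ t u → Star R t u → Normal R u → ¬ InfiniteFrom e t

-- Least-level reduction is diamond-like: two least-level steps from the same term have the same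
-- level and, unless they coincide, can be joined by one least-level step each. Hence (random
-- descent) all least-level sequences from a term reaching a normal form have the same length, and
-- none is infinite. It thus suffices to find one least-level sequence t →* u whenever t →* u with u
-- normal. By standardisation, t reduces to u by (weak) head steps, which have level 0, followed by
-- standard reductions inside the subterms of the head normal form; by induction these are
-- least-level, and for an application the two sides are merged in order of increasing level.

module Submission where

open import Defs
open import Data.Product using (_×_; Σ; _,_; proj₂)
open import Data.Sum using (_⊎_; inj₁; inj₂; [_,_]′)
open import Data.Empty using (⊥; ⊥-elim)
open import Data.Unit using (⊤; tt)
open import Data.Nat using (ℕ; zero; suc; _≤_; _<_; z≤n; s≤s; _<?_; _≟_; _⊓_)
open import Data.Nat.Properties
  using (<-cmp; ≤-refl; ≤-reflexive; ≤-trans; <-irrefl; ≤-antisym; <⇒≤; ≤-pred; ≤-<-connex; n≤1+n;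
         m⊓n≤m; m⊓n≤n; ⊓-glb; ⊓-sel)
open import Relation.Nullary using (¬_; yes; no)
open import Relation.Binary using (tri<; tri≈; tri>)
open import Relation.Binary.PropositionalEquality using (_≡_; _≗_; refl; sym; trans; cong; cong₂; module ≡-Reasoning)
open import Relation.Binary.Construct.Closure.ReflexiveTransitive using (Star; ε; _◅_; _◅◅_; gmap; map)

ext : (ℕ → ℕ) → ℕ → ℕ
ext ρ zero = zero
ext ρ (suc n) = suc (ρ n)

ren : (ℕ → ℕ) → Term → Term
ren ρ (var n) = var (ρ n)
ren ρ (lam t) = lam (ren (ext ρ) t)
ren ρ (app t s) = app (ren ρ t) (ren ρ s)

exts : (ℕ → Term) → ℕ → Term
exts σ zero = var zero
exts σ (suc n) = ren suc (σ n)

sub : (ℕ → Term) → Term → Term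
sub σ (var n) = σ n
sub σ (lam t) = lam (sub (exts σ) t)
sub σ (app t s) = app (sub σ t) (sub σ s)

_∷ₛ_ : Term → (ℕ → Term) → ℕ → Term
(s ∷ₛ σ) zero = s
(s ∷ₛ σ) (suc n) = σ n

_[_]₀ : Term → Term → Term
t [ s ]₀ = sub (s ∷ₛ var) t

ext-cong : ∀ {ρ ρ'} → ρ ≗ ρ' → ext ρ ≗ ext ρ'
ext-cong e zero = refl
ext-cong e (suc n) = cong suc (e n)

ren-cong : ∀ {ρ ρ'} → ρ ≗ ρ' → ∀ t → ren ρ t ≡ ren ρ' t
ren-cong e (var n) = cong var (e n)
ren-cong e (lam t) = cong lam (ren-cong (ext-cong e) t)
ren-cong e (app t s) = cong₂ app (ren-cong e t) (ren-cong e s)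

exts-cong : ∀ {σ σ'} → σ ≗ σ' → exts σ ≗ exts σ'
exts-cong e zero = refl
exts-cong e (suc n) = cong (ren suc) (e n)

sub-cong : ∀ {σ σ'} → σ ≗ σ' → ∀ t → sub σ t ≡ sub σ' t
sub-cong e (var n) = e n
sub-cong e (lam t) = cong lam (sub-cong (exts-cong e) t)
sub-cong e (app t s) = cong₂ app (sub-cong e t) (sub-cong e s)

sub-id : ∀ {σ} → σ ≗ var → ∀ t → sub σ t ≡ t
sub-id e (var n) = e n
sub-id e (lam t) = cong lam (sub-id (λ { zero → refl ; (suc n) → cong (ren suc) (e n) }) t)
sub-id e (app t s) = cong₂ app (sub-id e t) (sub-id e s)

ren-ren : ∀ ρ ρ' t → ren ρ (ren ρ' t) ≡ ren (λ n → ρ (ρ' n)) t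
ren-ren ρ ρ' (var n) = refl
ren-ren ρ ρ' (lam t) =
  cong lam (trans (ren-ren (ext ρ) (ext ρ') t) (ren-cong (λ { zero → refl ; (suc n) → refl }) t))
ren-ren ρ ρ' (app t s) = cong₂ app (ren-ren ρ ρ' t) (ren-ren ρ ρ' s)

sub-ren : ∀ σ ρ t → sub σ (ren ρ t) ≡ sub (λ n → σ (ρ n)) t
sub-ren σ ρ (var n) = refl
sub-ren σ ρ (lam t) =
  cong lam (trans (sub-ren (exts σ) (ext ρ) t) (sub-cong (λ { zero → refl ; (suc n) → refl }) t))
sub-ren σ ρ (app t s) = cong₂ app (sub-ren σ ρ t) (sub-ren σ ρ s)

ren-sub : ∀ ρ σ t → ren ρ (sub σ t) ≡ sub (λ n → ren ρ (σ n)) t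
ren-sub ρ σ (var n) = refl
ren-sub ρ σ (lam t) = cong lam (trans (ren-sub (ext ρ) (exts σ) t) (sub-cong commute t))
  where
  commute : (λ n → ren (ext ρ) (exts σ n)) ≗ exts (λ n → ren ρ (σ n))
  commute zero = refl
  commute (suc n) = trans (ren-ren (ext ρ) suc (σ n)) (sym (ren-ren suc ρ (σ n)))
ren-sub ρ σ (app t s) = cong₂ app (ren-sub ρ σ t) (ren-sub ρ σ s)

sub-sub : ∀ σ τ t → sub σ (sub τ t) ≡ sub (λ n → sub σ (τ n)) t
sub-sub σ τ (var n) = refl
sub-sub σ τ (lam t) = cong lam (trans (sub-sub (exts σ) (exts τ) t) (sub-cong commute t))
  where
  commute : (λ n → sub (exts σ) (exts τ n)) ≗ exts (λ n → sub σ (τ n))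
  commute zero = refl
  commute (suc n) = trans (sub-ren (exts σ) suc (τ n)) (sym (ren-sub suc σ (τ n)))
sub-sub σ τ (app t s) = cong₂ app (sub-sub σ τ t) (sub-sub σ τ s)

ren-[]₀ : ∀ ρ t s → ren ρ (t [ s ]₀) ≡ ren (ext ρ) t [ ren ρ s ]₀
ren-[]₀ ρ t s = trans (ren-sub ρ (s ∷ₛ var) t)
  (trans (sub-cong (λ { zero → refl ; (suc n) → refl }) t) (sym (sub-ren (ren ρ s ∷ₛ var) (ext ρ) t)))

sub-[]₀ : ∀ σ t s → sub σ (t [ s ]₀) ≡ sub (exts σ) t [ sub σ s ]₀
sub-[]₀ σ t s = begin
  sub σ (t [ s ]₀)                               ≡⟨ sub-sub σ (s ∷ₛ var) t ⟩
  sub (λ n → sub σ ((s ∷ₛ var) n)) t             ≡⟨ sub-cong commute t ⟩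
  sub (λ n → sub (sub σ s ∷ₛ var) (exts σ n)) t  ≡⟨ sym (sub-sub (sub σ s ∷ₛ var) (exts σ) t) ⟩
  sub (exts σ) t [ sub σ s ]₀                    ∎
  where
  open ≡-Reasoning
  commute : (λ n → sub σ ((s ∷ₛ var) n)) ≗ (λ n → sub (sub σ s ∷ₛ var) (exts σ n))
  commute zero = refl
  commute (suc n) = sym (trans (sub-ren (sub σ s ∷ₛ var) suc (σ n)) (sub-id (λ _ → refl) (σ n)))

shiftVar : ℕ → ℕ → ℕ
shiftVar c n with n <? c
... | yes _ = n
... | no _ = suc n

shiftVar-ext : ∀ c → shiftVar (suc c) ≗ ext (shiftVar c)
shiftVar-ext c zero with 0 <? suc c
... | yes _ = refl
... | no 0≮ = ⊥-elim (0≮ (s≤s z≤n))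
shiftVar-ext c (suc n) with suc n <? suc c | n <? c
... | yes _ | yes _ = refl
... | no _ | no _ = refl
... | yes (s≤s n<c) | no n≮c = ⊥-elim (n≮c n<c)
... | no sn≮sc | yes n<c = ⊥-elim (sn≮sc (s≤s n<c))

shift≡ren : ∀ c t → shift c t ≡ ren (shiftVar c) t
shift≡ren c (var n) with n <? c
... | yes _ = refl
... | no _ = refl
shift≡ren c (lam t) = cong lam (trans (shift≡ren (suc c) t) (ren-cong (shiftVar-ext c) t))
shift≡ren c (app t s) = cong₂ app (shift≡ren c t) (shift≡ren c s)

shift0≡ren-suc : ∀ t → shift 0 t ≡ ren suc t
shift0≡ren-suc t = trans (shift≡ren 0 t) (ren-cong shiftVar0 t)
  where
  shiftVar0 : shiftVar 0 ≗ suc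
  shiftVar0 n with n <? 0
  ... | no _ = refl

substVar : ℕ → Term → ℕ → Term
substVar k s n = subst k s (var n)

substVar-< : ∀ k s n → n < k → substVar k s n ≡ var n
substVar-< k s n n<k with n <? k
... | yes _ = refl
... | no n≮k = ⊥-elim (n≮k n<k)

substVar-≡ : ∀ k s → substVar k s k ≡ s
substVar-≡ k s with k <? k
... | yes k<k = ⊥-elim (<-irrefl refl k<k)
... | no _ with k ≟ k
...   | yes _ = refl
...   | no k≢k = ⊥-elim (k≢k refl)

substVar-> : ∀ k s n → k < suc n → substVar k s (suc n) ≡ var n
substVar-> k s n k≤n with suc n <? k
... | yes n<k = ⊥-elim (<-irrefl refl (≤-trans n<k (≤-pred (≤-trans k≤n (n≤1+n _)))))
... | no _ with suc n ≟ k
...   | yes refl = ⊥-elim (<-irrefl refl k≤n)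
...   | no _ = refl

substVar-exts : ∀ k s → exts (substVar k s) ≗ substVar (suc k) (shift 0 s)
substVar-exts k s zero = sym (substVar-< (suc k) (shift 0 s) 0 (s≤s z≤n))
substVar-exts k s (suc n) with <-cmp n k
... | tri< n<k _ _ =
  trans (cong (ren suc) (substVar-< k s n n<k)) (sym (substVar-< (suc k) (shift 0 s) (suc n) (s≤s n<k)))
... | tri≈ _ refl _ =
  trans (cong (ren suc) (substVar-≡ n s)) (sym (trans (substVar-≡ (suc n) (shift 0 s)) (shift0≡ren-suc s)))
substVar-exts k s (suc (suc m)) | tri> _ _ k<n =
  trans (cong (ren suc) (substVar-> k s m k<n)) (sym (substVar-> (suc k) (shift 0 s) (suc m) (s≤s k<n)))

subst≡sub : ∀ k s t → subst k s t ≡ sub (substVar k s) t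
subst≡sub k s (var n) = refl
subst≡sub k s (lam t) = cong lam (trans (subst≡sub (suc k) (shift 0 s) t) (sym (sub-cong (substVar-exts k s) t)))
subst≡sub k s (app t u) = cong₂ app (subst≡sub k s t) (subst≡sub k s u)

[/0]≡[]₀ : ∀ t s → t [ s /0] ≡ t [ s ]₀
[/0]≡[]₀ t s = trans (subst≡sub 0 s t) (sub-cong substVar0 t)
  where
  substVar0 : substVar 0 s ≗ (s ∷ₛ var)
  substVar0 zero = substVar-≡ 0 s
  substVar0 (suc n) = substVar-> 0 s n (s≤s z≤n)

infixl 7 _⊓∞_
infix 4 _≤∞_ _∞≤_

data ℕ∞ : Set where
  fin : ℕ → ℕ∞
  ∞ : ℕ∞

_⊓∞_ : ℕ∞ → ℕ∞ → ℕ∞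
∞ ⊓∞ y = y
fin m ⊓∞ ∞ = fin m
fin m ⊓∞ fin n = fin (m ⊓ n)

suc∞ : ℕ∞ → ℕ∞
suc∞ ∞ = ∞
suc∞ (fin m) = fin (suc m)

_≤∞_ : ℕ → ℕ∞ → Set
n ≤∞ ∞ = ⊤
n ≤∞ fin m = n ≤ m

_∞≤_ : ℕ∞ → ℕ → Set
∞ ∞≤ n = ⊥
fin m ∞≤ n = m ≤ n

z≤∞ : ∀ x → 0 ≤∞ x
z≤∞ ∞ = tt
z≤∞ (fin m) = z≤n

≤∞-∞ : ∀ {x} n → x ≡ ∞ → n ≤∞ x
≤∞-∞ n refl = tt

≤-≤∞-trans : ∀ {i j} x → i ≤ j → j ≤∞ x → i ≤∞ x
≤-≤∞-trans ∞ i≤j j≤x = tt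
≤-≤∞-trans (fin m) i≤j j≤x = ≤-trans i≤j j≤x

≤∞-∞≤-trans : ∀ {n m} x → n ≤∞ x → x ∞≤ m → n ≤ m
≤∞-∞≤-trans (fin k) n≤k k≤m = ≤-trans n≤k k≤m

⊓∞-glb : ∀ {n} x y → n ≤∞ x → n ≤∞ y → n ≤∞ x ⊓∞ y
⊓∞-glb ∞ y _ n≤y = n≤y
⊓∞-glb (fin a) ∞ n≤a _ = n≤a
⊓∞-glb (fin a) (fin b) n≤a n≤b = ⊓-glb n≤a n≤b

≤⊓∞⇒≤ˡ : ∀ {n} x y → n ≤∞ x ⊓∞ y → n ≤∞ x
≤⊓∞⇒≤ˡ ∞ y _ = tt
≤⊓∞⇒≤ˡ (fin a) ∞ n≤a = n≤a
≤⊓∞⇒≤ˡ (fin a) (fin b) n≤a⊓b = ≤-trans n≤a⊓b (m⊓n≤m a b)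

≤⊓∞⇒≤ʳ : ∀ {n} x y → n ≤∞ x ⊓∞ y → n ≤∞ y
≤⊓∞⇒≤ʳ ∞ y n≤y = n≤y
≤⊓∞⇒≤ʳ (fin a) ∞ _ = tt
≤⊓∞⇒≤ʳ (fin a) (fin b) n≤a⊓b = ≤-trans n≤a⊓b (m⊓n≤n a b)

⊓∞-∞≤ˡ : ∀ {n} x y → x ∞≤ n → x ⊓∞ y ∞≤ n
⊓∞-∞≤ˡ (fin a) ∞ a≤n = a≤n
⊓∞-∞≤ˡ (fin a) (fin b) a≤n = ≤-trans (m⊓n≤m a b) a≤n

⊓∞-∞≤ʳ : ∀ {n} x y → y ∞≤ n → x ⊓∞ y ∞≤ n
⊓∞-∞≤ʳ ∞ y b≤n = b≤n
⊓∞-∞≤ʳ (fin a) (fin b) b≤n = ≤-trans (m⊓n≤n a b) b≤n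

⊓∞-sel-fin : ∀ {m} x y → x ⊓∞ y ≡ fin m → x ≡ fin m ⊎ y ≡ fin m
⊓∞-sel-fin ∞ y e = inj₂ e
⊓∞-sel-fin (fin a) ∞ e = inj₁ e
⊓∞-sel-fin (fin a) (fin b) e with ⊓-sel a b
... | inj₁ a⊓b≡a = inj₁ (trans (cong fin (sym a⊓b≡a)) e)
... | inj₂ a⊓b≡b = inj₂ (trans (cong fin (sym a⊓b≡b)) e)

s≤∞suc∞ : ∀ {n} x → n ≤∞ x → suc n ≤∞ suc∞ x
s≤∞suc∞ ∞ _ = tt
s≤∞suc∞ (fin m) n≤m = s≤s n≤m

s≤∞suc∞⁻¹ : ∀ {n} x → suc n ≤∞ suc∞ x → n ≤∞ x
s≤∞suc∞⁻¹ ∞ _ = tt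
s≤∞suc∞⁻¹ (fin m) (s≤s n≤m) = n≤m

suc∞∞≤s : ∀ {n} x → x ∞≤ n → suc∞ x ∞≤ suc n
suc∞∞≤s (fin m) m≤n = s≤s m≤n

suc∞≡fin : ∀ {m} x → suc∞ x ≡ fin m → Σ ℕ λ m' → m ≡ suc m' × x ≡ fin m'
suc∞≡fin (fin a) refl = a , refl , refl

data Path (R : Rel) : ℕ → Term → Term → Set where
  ε : ∀ {t} → Path R 0 t t
  _◅_ : ∀ {k t u v} → R t u → Path R k u v → Path R (suc k) t v

toPath : ∀ {R t u} → Star R t u → Σ ℕ λ k → Path R k t u
toPath ε = 0 , ε
toPath (x ◅ xs) with toPath xs
... | k , p = suc k , (x ◅ p)

data NotLam : Term → Set where
  var : ∀ {n} → NotLam (var n)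
  app : ∀ {t s} → NotLam (app t s)

data IsApp : Term → Set where
  app : ∀ {t s} → IsApp (app t s)

-- t ⟶[ n ] u is a contextual step at level n (plug-step, step-plug), and minLevel t is the least
-- level of a step from t (minLevel-∞≤, minLevel-step).
module LeastLevel
  (_↦_ : Rel) (lev : Ctx → ℕ)
  (_⟶[_]_ : Term → ℕ → Term → Set)
  (minLevel : Term → ℕ∞)
  (plug-step : ∀ c {r r'} → r ↦ r' → plug c r ⟶[ lev c ] plug c r')
  (step-plug : ∀ {t n u} → t ⟶[ n ] u → Σ Ctx λ c → Σ Term λ r → Σ Term λ r' →
     t ≡ plug c r × u ≡ plug c r' × r ↦ r' × lev c ≡ n)
  (minLevel-∞≤ : ∀ {t n u} → t ⟶[ n ] u → minLevel t ∞≤ n)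
  (minLevel-step : ∀ t {m} → minLevel t ≡ fin m → Σ Term λ u → t ⟶[ m ] u)
  (≤∞-minLevel-step : ∀ {t n u} → t ⟶[ n ] u → n ≤∞ minLevel t → n ≤∞ minLevel u)
  (diamond : ∀ {t n u₁ u₂} → t ⟶[ n ] u₁ → t ⟶[ n ] u₂ →
     u₁ ≡ u₂ ⊎ Σ Term λ w → u₁ ⟶[ n ] w × u₂ ⟶[ n ] w)
  where

  _⟶ℓℓ_ : Rel
  t ⟶ℓℓ u = Σ ℕ λ n → t ⟶[ n ] u × n ≤∞ minLevel t

  Irreducible : Term → Set
  Irreducible t = ∀ n u → ¬ t ⟶[ n ] u

  minLevel-irreducible : ∀ t → Irreducible t → minLevel t ≡ ∞
  minLevel-irreducible t irr with minLevel t in eq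
  ... | ∞ = refl
  ... | fin m with minLevel-step t eq
  ...   | u , t⟶u = ⊥-elim (irr m u t⟶u)

  ⟶ℓℓ-exists : ∀ {t n u} → t ⟶[ n ] u → Σ Term λ u' → t ⟶ℓℓ u'
  ⟶ℓℓ-exists {t} t⟶u with minLevel t in eq | minLevel-∞≤ t⟶u
  ... | fin m | _ with minLevel-step t eq
  ...   | u' , t⟶u' = u' , m , t⟶u' , ≤-refl

  -- Two least-level steps have the same level, so the diamond closes with least-level steps.
  ⟶ℓℓ-diamond : ∀ {t u₁ u₂} → t ⟶ℓℓ u₁ → t ⟶ℓℓ u₂ → u₁ ≡ u₂ ⊎ Σ Term λ w → u₁ ⟶ℓℓ w × u₂ ⟶ℓℓ w
  ⟶ℓℓ-diamond {t} (n₁ , s₁ , ℓℓ₁) (n₂ , s₂ , ℓℓ₂)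
    with ≤-antisym (≤∞-∞≤-trans (minLevel t) ℓℓ₁ (minLevel-∞≤ s₂)) (≤∞-∞≤-trans (minLevel t) ℓℓ₂ (minLevel-∞≤ s₁))
  ... | refl with diamond s₁ s₂
  ...   | inj₁ u₁≡u₂ = inj₁ u₁≡u₂
  ...   | inj₂ (w , s₁' , s₂') =
    inj₂ (w , (n₁ , s₁' , ≤∞-minLevel-step s₁ ℓℓ₁) , (n₁ , s₂' , ≤∞-minLevel-step s₂ ℓℓ₂))

  -- Random descent: every least-level step shortens a least-level path to a normal form by one.
  descend : ∀ {k t u t'} → Path _⟶ℓℓ_ (suc k) t u → (∀ w → ¬ u ⟶ℓℓ w) → t ⟶ℓℓ t' → Path _⟶ℓℓ_ k t' u
  descend (s ◅ p) nf s' with ⟶ℓℓ-diamond s s'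
  ... | inj₁ refl = p
  descend {zero} (s ◅ ε) nf s' | inj₂ (w , s₁ , _) = ⊥-elim (nf w s₁)
  descend {suc k} (s ◅ p) nf s' | inj₂ (w , s₁ , s₁') = s₁' ◅ descend p nf s₁

  no-infinite-⟶ℓℓ : ∀ {k t u} → Path _⟶ℓℓ_ k t u → (∀ w → ¬ u ⟶ℓℓ w) →
    (f : ℕ → Term) (i : ℕ) → f i ≡ t → ¬ (∀ j → f j ⟶ℓℓ f (suc j))
  no-infinite-⟶ℓℓ ε nf f i refl steps = nf _ (steps i)
  no-infinite-⟶ℓℓ (s ◅ p) nf f i refl steps =
    no-infinite-⟶ℓℓ (descend (s ◅ p) nf (steps i)) nf f (suc i) refl steps

  private
    _⟶_ _⟶ₑ_ : Rel
    _⟶_ = ctxClosure _↦_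
    _⟶ₑ_ = leastLevel _↦_ lev

  ⟶⇒graded : ∀ {t u} → t ⟶ u → Σ ℕ λ n → t ⟶[ n ] u
  ⟶⇒graded (c , r , r' , refl , refl , r↦r') = lev c , plug-step c r↦r'

  ⟶ₑ⇒⟶ℓℓ : ∀ {t u} → t ⟶ₑ u → t ⟶ℓℓ u
  ⟶ₑ⇒⟶ℓℓ (c , r , r' , refl , refl , r↦r' , least) with minLevel (plug c r) in eq | minLevel-∞≤ (plug-step c r↦r')
  ... | fin m | _ with step-plug (proj₂ (minLevel-step (plug c r) eq))
  ...   | c' , r₁ , _ , t≡c'[r₁] , _ , r₁↦ , lev-c'≡m =
    lev c , plug-step c r↦r' , ≤-trans (least c' r₁ _ t≡c'[r₁] r₁↦) (≤-reflexive lev-c'≡m)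

  ⟶ℓℓ⇒⟶ₑ : ∀ {t u} → t ⟶ℓℓ u → t ⟶ₑ u
  ⟶ℓℓ⇒⟶ₑ {t} (n , s , ℓℓ) with step-plug s
  ... | c , r , r' , t≡c[r] , u≡c[r'] , r↦r' , refl = c , r , r' , t≡c[r] , u≡c[r'] , r↦r' , least
    where
    least : ∀ c' r₁ r₁' → t ≡ plug c' r₁ → r₁ ↦ r₁' → lev c ≤ lev c'
    least c' r₁ r₁' refl r₁↦ = ≤∞-∞≤-trans (minLevel t) ℓℓ (minLevel-∞≤ (plug-step c' r₁↦))

  normal⇒irreducible : ∀ {t} → Normal _⟶_ t → Irreducible t
  normal⇒irreducible nf n u s with step-plug s
  ... | c , r , r' , t≡ , u≡ , r↦r' , _ = nf u (c , r , r' , t≡ , u≡ , r↦r')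

  normalizingStrategy : (∀ {t u} → Star _⟶_ t u → Irreducible u → Star _⟶ℓℓ_ t u) →
    NormalizingStrategy _⟶ₑ_ _⟶_
  normalizingStrategy standardise = record
    { sub = λ _ _ → forget
    ; sameNF = λ t → (λ nfₑ u s → let (n , s') = ⟶⇒graded s ; (u' , sℓℓ) = ⟶ℓℓ-exists s' in
                                     nfₑ u' (⟶ℓℓ⇒⟶ₑ sℓℓ))
                   , (λ nf u s → nf u (forget s))
    ; normalizes = λ t u t⟶*u nf (f , f0≡t , steps) →
        let irr = normal⇒irreducible nf
            (k , p) = toPath (standardise t⟶*u irr)
        in no-infinite-⟶ℓℓ p (λ w (n , s , _) → irr n w s) f 0 f0≡t (λ j → ⟶ₑ⇒⟶ℓℓ (steps j))
    }
    where
    forget : ∀ {t u} → t ⟶ₑ u → t ⟶ u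
    forget (c , r , r' , t≡ , u≡ , r↦r' , _) = c , r , r' , t≡ , u≡ , r↦r'

-- t ⇝ u: a standard reduction, which first performs head steps and then standard reductions
-- inside the subterms of the head normal form reached.
module Standardisation
  (_⟶h_ : Rel)
  (Admissible : (ℕ → Term) → Set)
  (admissible-exts : ∀ {σ} → Admissible σ → Admissible (exts σ))
  (⟶h-ren : ∀ ρ {t t'} → t ⟶h t' → ren ρ t ⟶h ren ρ t')
  (⟶h-sub : ∀ {σ} → Admissible σ → ∀ {t t'} → t ⟶h t' → sub σ t ⟶h sub σ t')
  where

  infix 4 _⇝_
  data _⇝_ : Rel where
    ⇝var : ∀ {t x} → Star _⟶h_ t (var x) → t ⇝ var x
    ⇝lam : ∀ {t p q} → Star _⟶h_ t (lam p) → p ⇝ q → t ⇝ lam q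
    ⇝app : ∀ {t p r p' r'} → Star _⟶h_ t (app p r) → p ⇝ p' → r ⇝ r' → t ⇝ app p' r'

  ⇝-refl : ∀ t → t ⇝ t
  ⇝-refl (var x) = ⇝var ε
  ⇝-refl (lam t) = ⇝lam ε (⇝-refl t)
  ⇝-refl (app t s) = ⇝app ε (⇝-refl t) (⇝-refl s)

  ⟶h*-⇝ : ∀ {t t' u} → Star _⟶h_ t t' → t' ⇝ u → t ⇝ u
  ⟶h*-⇝ hs (⇝var hs') = ⇝var (hs ◅◅ hs')
  ⟶h*-⇝ hs (⇝lam hs' p) = ⇝lam (hs ◅◅ hs') p
  ⟶h*-⇝ hs (⇝app hs' p r) = ⇝app (hs ◅◅ hs') p r

  ⇝-ren : ∀ ρ {t u} → t ⇝ u → ren ρ t ⇝ ren ρ u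
  ⇝-ren ρ (⇝var hs) = ⇝var (gmap (ren ρ) (⟶h-ren ρ) hs)
  ⇝-ren ρ (⇝lam hs p) = ⇝lam (gmap (ren ρ) (⟶h-ren ρ) hs) (⇝-ren (ext ρ) p)
  ⇝-ren ρ (⇝app hs p r) = ⇝app (gmap (ren ρ) (⟶h-ren ρ) hs) (⇝-ren ρ p) (⇝-ren ρ r)

  ⇝-sub : ∀ {σ σ' t u} → Admissible σ → (∀ n → σ n ⇝ σ' n) → t ⇝ u → sub σ t ⇝ sub σ' u
  ⇝-sub {σ} adm σ⇝σ' (⇝var {x = x} hs) = ⟶h*-⇝ (gmap (sub σ) (⟶h-sub adm) hs) (σ⇝σ' x)
  ⇝-sub {σ} adm σ⇝σ' (⇝lam hs p) =
    ⇝lam (gmap (sub σ) (⟶h-sub adm) hs) (⇝-sub (admissible-exts adm) exts⇝exts p)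
    where
    exts⇝exts : ∀ n → exts _ n ⇝ exts _ n
    exts⇝exts zero = ⇝var ε
    exts⇝exts (suc n) = ⇝-ren suc (σ⇝σ' n)
  ⇝-sub {σ} adm σ⇝σ' (⇝app hs p r) = ⇝app (gmap (sub σ) (⟶h-sub adm) hs) (⇝-sub adm σ⇝σ' p) (⇝-sub adm σ⇝σ' r)

  ⇝-[]₀ : ∀ {t t' s s'} → Admissible (s ∷ₛ var) → t ⇝ t' → s ⇝ s' → t [ s ]₀ ⇝ t' [ s' ]₀
  ⇝-[]₀ adm t⇝t' s⇝s' = ⇝-sub adm (λ { zero → s⇝s' ; (suc n) → ⇝var ε }) t⇝t'

module CallByName where

  infix 4 _⟶[_]_
  data _⟶[_]_ : Term → ℕ → Term → Set where
    root : ∀ t s → app (lam t) s ⟶[ 0 ] t [ s ]₀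
    under-lam : ∀ {t u n} → t ⟶[ n ] u → lam t ⟶[ n ] lam u
    left : ∀ {t u s n} → t ⟶[ n ] u → app t s ⟶[ n ] app u s
    right : ∀ {t s u n} → s ⟶[ n ] u → app t s ⟶[ suc n ] app t u

  minLevel : Term → ℕ∞
  minLevel (var x) = ∞
  minLevel (lam t) = minLevel t
  minLevel (app (lam t) s) = fin 0
  minLevel (app (var x) s) = suc∞ (minLevel s)
  minLevel (app (app t r) s) = minLevel (app t r) ⊓∞ suc∞ (minLevel s)

  minLevel-app : ∀ {t} s → NotLam t → minLevel (app t s) ≡ minLevel t ⊓∞ suc∞ (minLevel s)
  minLevel-app s var = refl
  minLevel-app s app = refl

  plug-step : ∀ c {r r'} → r ↦β r' → plug c r ⟶[ levN c ] plug c r'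
  plug-step hole (beta t s) rewrite [/0]≡[]₀ t s = root t s
  plug-step (appR t c) r↦r' = right (plug-step c r↦r')
  plug-step (appL c t) r↦r' = left (plug-step c r↦r')
  plug-step (lamC c) r↦r' = under-lam (plug-step c r↦r')

  step-plug : ∀ {t n u} → t ⟶[ n ] u → Σ Ctx λ c → Σ Term λ r → Σ Term λ r' →
    t ≡ plug c r × u ≡ plug c r' × r ↦β r' × levN c ≡ n
  step-plug (root t s) = hole , app (lam t) s , t [ s /0] , refl , sym ([/0]≡[]₀ t s) , beta t s , refl
  step-plug (under-lam st) with step-plug st
  ... | c , r , r' , refl , refl , r↦r' , refl = lamC c , r , r' , refl , refl , r↦r' , refl
  step-plug (left {s = s} st) with step-plug st
  ... | c , r , r' , refl , refl , r↦r' , refl = appL c s , r , r' , refl , refl , r↦r' , refl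
  step-plug (right {t = t} st) with step-plug st
  ... | c , r , r' , refl , refl , r↦r' , refl = appR t c , r , r' , refl , refl , r↦r' , refl

  minLevel-∞≤ : ∀ {t n u} → t ⟶[ n ] u → minLevel t ∞≤ n
  minLevel-∞≤ (root t s) = z≤n
  minLevel-∞≤ (under-lam st) = minLevel-∞≤ st
  minLevel-∞≤ (left {t = var _} ())
  minLevel-∞≤ (left {t = lam _} st) = z≤n
  minLevel-∞≤ (left {t = app t r} {s = s} st) = ⊓∞-∞≤ˡ (minLevel (app t r)) (suc∞ (minLevel s)) (minLevel-∞≤ st)
  minLevel-∞≤ (right {t = lam _} st) = z≤n
  minLevel-∞≤ (right {t = var _} {s = s} st) = suc∞∞≤s (minLevel s) (minLevel-∞≤ st)
  minLevel-∞≤ (right {t = app t r} {s = s} st) =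
    ⊓∞-∞≤ʳ (minLevel (app t r)) (suc∞ (minLevel s)) (suc∞∞≤s (minLevel s) (minLevel-∞≤ st))

  HasStepAtMinLevel : Term → Set
  HasStepAtMinLevel t = ∀ {m} → minLevel t ≡ fin m → Σ Term λ u → t ⟶[ m ] u

  app-hasStepAtMinLevel : ∀ {t} s → NotLam t → HasStepAtMinLevel t → HasStepAtMinLevel s →
    HasStepAtMinLevel (app t s)
  app-hasStepAtMinLevel {t} s nl step-t step-s e
    with ⊓∞-sel-fin (minLevel t) (suc∞ (minLevel s)) (trans (sym (minLevel-app s nl)) e)
  ... | inj₁ e' = let (u , st) = step-t e' in app u s , left st
  ... | inj₂ e' with suc∞≡fin (minLevel s) e'
  ...   | _ , refl , e'' = let (u , st) = step-s e'' in app t u , right st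

  minLevel-step : ∀ t → HasStepAtMinLevel t
  minLevel-step (var x) ()
  minLevel-step (lam t) e = let (u , st) = minLevel-step t e in lam u , under-lam st
  minLevel-step (app (lam t) s) refl = t [ s ]₀ , root t s
  minLevel-step (app (var x) s) = app-hasStepAtMinLevel s var (minLevel-step (var x)) (minLevel-step s)
  minLevel-step (app (app t r) s) = app-hasStepAtMinLevel s app (minLevel-step (app t r)) (minLevel-step s)

  ≤∞-minLevel-step : ∀ {t n u} → t ⟶[ n ] u → n ≤∞ minLevel t → n ≤∞ minLevel u
  ≤∞-minLevel-step {n = zero} {u = u} _ _ = z≤∞ (minLevel u)
  ≤∞-minLevel-step {n = suc n} (under-lam st) n≤ = ≤∞-minLevel-step st n≤
  ≤∞-minLevel-step {n = suc n} (left {t = lam _} st) ()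
  ≤∞-minLevel-step {n = suc n} (left {t = app t₁ t₂} {s = s} st) n≤ with st
  ... | left {u = u₁} _ = ⊓∞-glb (minLevel (app u₁ t₂)) (suc∞ (minLevel s))
          (≤∞-minLevel-step st (≤⊓∞⇒≤ˡ (minLevel (app t₁ t₂)) _ n≤)) (≤⊓∞⇒≤ʳ (minLevel (app t₁ t₂)) _ n≤)
  ... | right {u = u₂} _ = ⊓∞-glb (minLevel (app t₁ u₂)) (suc∞ (minLevel s))
          (≤∞-minLevel-step st (≤⊓∞⇒≤ˡ (minLevel (app t₁ t₂)) _ n≤)) (≤⊓∞⇒≤ʳ (minLevel (app t₁ t₂)) _ n≤)
  ≤∞-minLevel-step {n = suc n} (right {t = lam _} st) ()
  ≤∞-minLevel-step {n = suc n} (right {t = var _} {s = s} {u = u} st) n≤ =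
    s≤∞suc∞ (minLevel u) (≤∞-minLevel-step st (s≤∞suc∞⁻¹ (minLevel s) n≤))
  ≤∞-minLevel-step {n = suc n} (right {t = app t₁ t₂} {s = s} {u = u} st) n≤ =
    ⊓∞-glb (minLevel (app t₁ t₂)) (suc∞ (minLevel u)) (≤⊓∞⇒≤ˡ (minLevel (app t₁ t₂)) _ n≤)
      (s≤∞suc∞ (minLevel u) (≤∞-minLevel-step st (s≤∞suc∞⁻¹ (minLevel s) (≤⊓∞⇒≤ʳ (minLevel (app t₁ t₂)) _ n≤))))

  step-sub : ∀ {t n t'} → t ⟶[ n ] t' → ∀ σ → sub σ t ⟶[ n ] sub σ t'
  step-sub (root t s) σ rewrite sub-[]₀ σ t s = root (sub (exts σ) t) (sub σ s)
  step-sub (under-lam st) σ = under-lam (step-sub st (exts σ))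
  step-sub (left st) σ = left (step-sub st σ)
  step-sub (right st) σ = right (step-sub st σ)

  diamond : ∀ {t n u₁ u₂} → t ⟶[ n ] u₁ → t ⟶[ n ] u₂ → u₁ ≡ u₂ ⊎ Σ Term λ w → u₁ ⟶[ n ] w × u₂ ⟶[ n ] w
  diamond (root t s) (root .t .s) = inj₁ refl
  diamond (root t s) (left (under-lam {u = t'} st)) = inj₂ (t' [ s ]₀ , step-sub st (s ∷ₛ var) , root t' s)
  diamond (left (under-lam {u = t'} st)) (root t s) = inj₂ (t' [ s ]₀ , root t' s , step-sub st (s ∷ₛ var))
  diamond (under-lam st₁) (under-lam st₂) with diamond st₁ st₂
  ... | inj₁ refl = inj₁ refl
  ... | inj₂ (w , st₁' , st₂') = inj₂ (lam w , under-lam st₁' , under-lam st₂')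
  diamond (left st₁) (left st₂) with diamond st₁ st₂
  ... | inj₁ refl = inj₁ refl
  ... | inj₂ (w , st₁' , st₂') = inj₂ (app w _ , left st₁' , left st₂')
  diamond (left {u = u₁} st₁) (right {u = u₂} st₂) = inj₂ (app u₁ u₂ , right st₂ , left st₁)
  diamond (right {u = u₂} st₂) (left {u = u₁} st₁) = inj₂ (app u₁ u₂ , left st₁ , right st₂)
  diamond (right st₁) (right st₂) with diamond st₁ st₂
  ... | inj₁ refl = inj₁ refl
  ... | inj₂ (w , st₁' , st₂') = inj₂ (app _ w , right st₁' , right st₂')

  infix 4 _⟶w_
  data _⟶w_ : Rel where
    w-root : ∀ t s → app (lam t) s ⟶w t [ s ]₀
    w-left : ∀ {t t' s} → t ⟶w t' → app t s ⟶w app t' s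

  ⟶w-ren : ∀ ρ {t t'} → t ⟶w t' → ren ρ t ⟶w ren ρ t'
  ⟶w-ren ρ (w-root t s) rewrite ren-[]₀ ρ t s = w-root (ren (ext ρ) t) (ren ρ s)
  ⟶w-ren ρ (w-left st) = w-left (⟶w-ren ρ st)

  ⟶w-sub : ∀ {σ} → ⊤ → ∀ {t t'} → t ⟶w t' → sub σ t ⟶w sub σ t'
  ⟶w-sub {σ} _ (w-root t s) rewrite sub-[]₀ σ t s = w-root (sub (exts σ) t) (sub σ s)
  ⟶w-sub _ (w-left st) = w-left (⟶w-sub tt st)

  open Standardisation _⟶w_ (λ _ → ⊤) (λ _ → tt) ⟶w-ren ⟶w-sub

  ⇝-step : ∀ {t u n u'} → t ⇝ u → u ⟶[ n ] u' → t ⇝ u'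
  ⇝-step (⇝lam hs p) (under-lam st) = ⇝lam hs (⇝-step p st)
  ⇝-step (⇝app hs p r) (left st) = ⇝app hs (⇝-step p st) r
  ⇝-step (⇝app hs p r) (right st) = ⇝app hs p (⇝-step r st)
  ⇝-step (⇝app {r = s} hs (⇝lam {p = t} hs' p) r) (root _ _) =
    ⟶h*-⇝ (hs ◅◅ gmap (λ x → app x s) w-left hs' ◅◅ w-root t s ◅ ε) (⇝-[]₀ tt p r)

  ⟶β*⇒⇝ : ∀ {t u} → Star _→β_ t u → t ⇝ u
  ⟶β*⇒⇝ = go (⇝-refl _)
    where
    go : ∀ {t m u} → t ⇝ m → Star _→β_ m u → t ⇝ u
    go t⇝m ε = t⇝m
    go t⇝m ((c , r , r' , refl , refl , r↦r') ◅ steps) = go (⇝-step t⇝m (plug-step c r↦r')) steps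

  open LeastLevel _↦β_ levN _⟶[_]_ minLevel plug-step step-plug minLevel-∞≤ minLevel-step ≤∞-minLevel-step diamond

  ⟶w⇒⟶ℓℓ : ∀ {t t'} → t ⟶w t' → t ⟶ℓℓ t'
  ⟶w⇒⟶ℓℓ {t} st = 0 , level0 st , z≤∞ (minLevel t)
    where
    level0 : ∀ {t t'} → t ⟶w t' → t ⟶[ 0 ] t'
    level0 (w-root t s) = root t s
    level0 (w-left st) = left (level0 st)

  lam-⟶ℓℓ* : ∀ {p q} → Star _⟶ℓℓ_ p q → Star _⟶ℓℓ_ (lam p) (lam q)
  lam-⟶ℓℓ* = gmap lam λ (n , st , n≤) → n , under-lam st , n≤

  ⟶ℓℓ*-notLam : ∀ {p p'} → Star _⟶ℓℓ_ p p' → NotLam p' → NotLam p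
  ⟶ℓℓ*-notLam {var x} _ _ = var
  ⟶ℓℓ*-notLam {app _ _} _ _ = app
  ⟶ℓℓ*-notLam {lam _} ε ()
  ⟶ℓℓ*-notLam {lam _} ((_ , under-lam _ , _) ◅ steps) nl with ⟶ℓℓ*-notLam steps nl
  ... | ()

  ≤∞-minLevel-app : ∀ {p r n} → NotLam p → n ≤∞ minLevel p → n ≤∞ suc∞ (minLevel r) → n ≤∞ minLevel (app p r)
  ≤∞-minLevel-app {p} {r} nl n≤p n≤r rewrite minLevel-app r nl = ⊓∞-glb (minLevel p) (suc∞ (minLevel r)) n≤p n≤r

  -- In app p r, least-level reduction may interleave the two sides: at each stage the side whose
  -- next step has the lower level goes first (left side on ties).
  app-⟶ℓℓ* : ∀ {p p' r r'} → Star _⟶ℓℓ_ p p' → Star _⟶ℓℓ_ r r' → Irreducible p' → Irreducible r' → NotLam p' →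
    Star _⟶ℓℓ_ (app p r) (app p' r')
  app-⟶ℓℓ* ε ε _ _ _ = ε
  app-⟶ℓℓ* {p} {r = r} ε ((k , st , k≤) ◅ rs) irr-p irr-r nl =
    (suc k , right st , ≤∞-minLevel-app {p} {r} nl (≤∞-∞ (suc k) (minLevel-irreducible p irr-p)) (s≤∞suc∞ _ k≤))
    ◅ app-⟶ℓℓ* ε rs irr-p irr-r nl
  app-⟶ℓℓ* {p} {r = r} ps@((i , st , i≤) ◅ ps') ε irr-p irr-r nl =
    (i , left st , ≤∞-minLevel-app {p} {r} (⟶ℓℓ*-notLam ps nl) i≤
                     (≤∞-∞ i (cong suc∞ (minLevel-irreducible r irr-r))))
    ◅ app-⟶ℓℓ* ps' ε irr-p irr-r nl
  app-⟶ℓℓ* {p} {r = r} ps@((i , st , i≤) ◅ ps') rs@((k , st' , k≤) ◅ rs') irr-p irr-r nl =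
    [ (λ i≤sk → (i , left st , ≤∞-minLevel-app {p} {r} (⟶ℓℓ*-notLam ps nl) i≤
                                 (≤-≤∞-trans (suc∞ (minLevel r)) i≤sk (s≤∞suc∞ (minLevel r) k≤)))
                ◅ app-⟶ℓℓ* ps' rs irr-p irr-r nl)
    , (λ sk<i → (suc k , right st' , ≤∞-minLevel-app {p} {r} (⟶ℓℓ*-notLam ps nl)
                                       (≤-≤∞-trans (minLevel p) (<⇒≤ sk<i) i≤) (s≤∞suc∞ (minLevel r) k≤))
                ◅ app-⟶ℓℓ* ps rs' irr-p irr-r nl)
    ]′ (≤-<-connex i (suc k))

  irreducible-app-notLam : ∀ {p r} → Irreducible (app p r) → NotLam p
  irreducible-app-notLam {var x} _ = var
  irreducible-app-notLam {app _ _} _ = app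
  irreducible-app-notLam {lam t} {r} irr = ⊥-elim (irr 0 (t [ r ]₀) (root t r))

  ⇝⇒⟶ℓℓ* : ∀ {t u} → t ⇝ u → Irreducible u → Star _⟶ℓℓ_ t u
  ⇝⇒⟶ℓℓ* (⇝var hs) _ = map ⟶w⇒⟶ℓℓ hs
  ⇝⇒⟶ℓℓ* (⇝lam hs p) irr =
    map ⟶w⇒⟶ℓℓ hs ◅◅ lam-⟶ℓℓ* (⇝⇒⟶ℓℓ* p λ n u st → irr n (lam u) (under-lam st))
  ⇝⇒⟶ℓℓ* (⇝app {p' = p'} {r' = r'} hs p r) irr =
    map ⟶w⇒⟶ℓℓ hs ◅◅ app-⟶ℓℓ* (⇝⇒⟶ℓℓ* p irr-p') (⇝⇒⟶ℓℓ* r irr-r') irr-p' irr-r' (irreducible-app-notLam irr)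
    where
    irr-p' : Irreducible p'
    irr-p' n u st = irr n (app u r') (left st)
    irr-r' : Irreducible r'
    irr-r' n u st = irr (suc n) (app p' u) (right st)

  normalizing : NormalizingStrategy _→llβ_ _→β_
  normalizing = normalizingStrategy λ t⟶*u irr → ⇝⇒⟶ℓℓ* (⟶β*⇒⇝ t⟶*u) irr

value-ren : ∀ ρ {v} → Value v → Value (ren ρ v)
value-ren ρ (var n) = var _
value-ren ρ (lam t) = lam _

value-sub : ∀ {σ} → (∀ n → Value (σ n)) → ∀ {v} → Value v → Value (sub σ v)
value-sub σ-val (var n) = σ-val n
value-sub σ-val (lam t) = lam _

value-exts : ∀ {σ} → (∀ n → Value (σ n)) → ∀ n → Value (exts σ n)
value-exts σ-val zero = var zero
value-exts σ-val (suc n) = value-ren suc (σ-val n)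

value-∷ₛ : ∀ {v} → Value v → ∀ n → Value ((v ∷ₛ var) n)
value-∷ₛ v-val zero = v-val
value-∷ₛ v-val (suc n) = var n

module CallByValue where

  infix 4 _⟶[_]_
  data _⟶[_]_ : Term → ℕ → Term → Set where
    root : ∀ t s → Value s → app (lam t) s ⟶[ 0 ] t [ s ]₀
    under-lam : ∀ {t u n} → t ⟶[ n ] u → lam t ⟶[ suc n ] lam u
    left-lam : ∀ {t u s n} → t ⟶[ n ] u → app (lam t) s ⟶[ n ] app (lam u) s
    left : ∀ {t u s n} → NotLam t → t ⟶[ n ] u → app t s ⟶[ n ] app u s
    right : ∀ {t s u n} → s ⟶[ n ] u → app t s ⟶[ n ] app t u

  minLevel : Term → ℕ∞
  minLevel (var x) = ∞
  minLevel (lam t) = suc∞ (minLevel t)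
  minLevel (app (var x) s) = minLevel s
  minLevel (app (lam t) (var y)) = fin 0
  minLevel (app (lam t) (lam s)) = fin 0
  minLevel (app (lam t) (app s₁ s₂)) = minLevel t ⊓∞ minLevel (app s₁ s₂)
  minLevel (app (app t r) s) = minLevel (app t r) ⊓∞ minLevel s

  -- The least level of t in function position: the body of an abstraction is not under an extra λ there.
  minLevelₗ : Term → ℕ∞
  minLevelₗ (var x) = ∞
  minLevelₗ (lam t) = minLevel t
  minLevelₗ (app t s) = minLevel (app t s)

  NotRedex : Term → Term → Set
  NotRedex p r = NotLam p ⊎ IsApp r

  minLevel-app : ∀ {p r} → NotRedex p r → minLevel (app p r) ≡ minLevelₗ p ⊓∞ minLevel r
  minLevel-app (inj₁ var) = refl
  minLevel-app (inj₁ app) = refl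
  minLevel-app {var _} (inj₂ app) = refl
  minLevel-app {lam _} (inj₂ app) = refl
  minLevel-app {app _ _} (inj₂ app) = refl

  plug-step : ∀ c {r r'} → r ↦βv r' → plug c r ⟶[ levV c ] plug c r'
  plug-step hole (betav t s s-val) rewrite [/0]≡[]₀ t s = root t s s-val
  plug-step (appR t c) r↦r' = right (plug-step c r↦r')
  plug-step (appL (lamC c) t) r↦r' = left-lam (plug-step c r↦r')
  plug-step (appL hole t) r↦r'@(betav _ _ _) = left app (plug-step hole r↦r')
  plug-step (appL c@(appR _ _) t) r↦r' = left app (plug-step c r↦r')
  plug-step (appL c@(appL _ _) t) r↦r' = left app (plug-step c r↦r')
  plug-step (lamC c) r↦r' = under-lam (plug-step c r↦r')

  levV-appL : ∀ c s {r} → NotLam (plug c r) → levV (appL c s) ≡ levV c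
  levV-appL hole s _ = refl
  levV-appL (appR _ _) s _ = refl
  levV-appL (appL _ _) s _ = refl
  levV-appL (lamC c) s ()

  step-plug : ∀ {t n u} → t ⟶[ n ] u → Σ Ctx λ c → Σ Term λ r → Σ Term λ r' →
    t ≡ plug c r × u ≡ plug c r' × r ↦βv r' × levV c ≡ n
  step-plug (root t s s-val) =
    hole , app (lam t) s , t [ s /0] , refl , sym ([/0]≡[]₀ t s) , betav t s s-val , refl
  step-plug (under-lam st) with step-plug st
  ... | c , r , r' , refl , refl , r↦r' , refl = lamC c , r , r' , refl , refl , r↦r' , refl
  step-plug (left-lam {s = s} st) with step-plug st
  ... | c , r , r' , refl , refl , r↦r' , refl = appL (lamC c) s , r , r' , refl , refl , r↦r' , refl
  step-plug (left {s = s} nl st) with step-plug st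
  ... | c , r , r' , refl , refl , r↦r' , refl = appL c s , r , r' , refl , refl , r↦r' , levV-appL c s nl
  step-plug (right {t = t} st) with step-plug st
  ... | c , r , r' , refl , refl , r↦r' , refl = appR t c , r , r' , refl , refl , r↦r' , refl

  minLevel-∞≤ : ∀ {t n u} → t ⟶[ n ] u → minLevel t ∞≤ n
  minLevel-∞≤ (root t (var x) _) = z≤n
  minLevel-∞≤ (root t (lam s) _) = z≤n
  minLevel-∞≤ (under-lam {t = t} st) = suc∞∞≤s (minLevel t) (minLevel-∞≤ st)
  minLevel-∞≤ (left-lam {s = var _} st) = z≤n
  minLevel-∞≤ (left-lam {s = lam _} st) = z≤n
  minLevel-∞≤ (left-lam {t = t} {s = app s₁ s₂} st) = ⊓∞-∞≤ˡ (minLevel t) (minLevel (app s₁ s₂)) (minLevel-∞≤ st)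
  minLevel-∞≤ (left var ())
  minLevel-∞≤ (left {t = app t r} {s = s} app st) = ⊓∞-∞≤ˡ (minLevel (app t r)) (minLevel s) (minLevel-∞≤ st)
  minLevel-∞≤ (right {t = var _} st) = minLevel-∞≤ st
  minLevel-∞≤ (right {t = lam _} {s = var _} ())
  minLevel-∞≤ (right {t = lam _} {s = lam _} st) = z≤n
  minLevel-∞≤ (right {t = lam t} {s = app s₁ s₂} st) = ⊓∞-∞≤ʳ (minLevel t) (minLevel (app s₁ s₂)) (minLevel-∞≤ st)
  minLevel-∞≤ (right {t = app t r} {s = s} st) = ⊓∞-∞≤ʳ (minLevel (app t r)) (minLevel s) (minLevel-∞≤ st)

  minLevel-step : ∀ t {m} → minLevel t ≡ fin m → Σ Term λ u → t ⟶[ m ] u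
  minLevel-step (var x) ()
  minLevel-step (lam t) e with suc∞≡fin (minLevel t) e
  ... | _ , refl , e' = let (u , st) = minLevel-step t e' in lam u , under-lam st
  minLevel-step (app (var x) s) e = let (u , st) = minLevel-step s e in app (var x) u , right st
  minLevel-step (app (lam t) (var y)) refl = t [ var y ]₀ , root t (var y) (var y)
  minLevel-step (app (lam t) (lam s)) refl = t [ lam s ]₀ , root t (lam s) (lam s)
  minLevel-step (app (lam t) (app s₁ s₂)) e =
    [ (λ e' → let (u , st) = minLevel-step t e' in app (lam u) (app s₁ s₂) , left-lam st)
    , (λ e' → let (u , st) = minLevel-step (app s₁ s₂) e' in app (lam t) u , right st)
    ]′ (⊓∞-sel-fin (minLevel t) (minLevel (app s₁ s₂)) e)
  minLevel-step (app (app t r) s) e =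
    [ (λ e' → let (u , st) = minLevel-step (app t r) e' in app u s , left app st)
    , (λ e' → let (u , st) = minLevel-step s e' in app (app t r) u , right st)
    ]′ (⊓∞-sel-fin (minLevel (app t r)) (minLevel s) e)

  -- Only root steps, which have level 0, can turn an application into something else.
  app-step-suc : ∀ {t s n u} → app t s ⟶[ suc n ] u → IsApp u
  app-step-suc (left-lam _) = app
  app-step-suc (left _ _) = app
  app-step-suc (right _) = app

  ≤∞-minLevel-step : ∀ {t n u} → t ⟶[ n ] u → n ≤∞ minLevel t → n ≤∞ minLevel u
  ≤∞-minLevel-step {n = zero} {u = u} _ _ = z≤∞ (minLevel u)
  ≤∞-minLevel-step {n = suc n} (under-lam {t = t} {u = u} st) n≤ =
    s≤∞suc∞ (minLevel u) (≤∞-minLevel-step st (s≤∞suc∞⁻¹ (minLevel t) n≤))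
  ≤∞-minLevel-step {n = suc n} (left-lam {s = var _} st) ()
  ≤∞-minLevel-step {n = suc n} (left-lam {s = lam _} st) ()
  ≤∞-minLevel-step {n = suc n} (left-lam {t = t} {u = u} {s = app s₁ s₂} st) n≤ =
    ⊓∞-glb (minLevel u) (minLevel (app s₁ s₂))
      (≤∞-minLevel-step st (≤⊓∞⇒≤ˡ (minLevel t) _ n≤)) (≤⊓∞⇒≤ʳ (minLevel t) _ n≤)
  ≤∞-minLevel-step {n = suc n} (left {t = app t r} {s = s} app st) n≤ with app-step-suc st
  ... | app {u₁} {u₂} = ⊓∞-glb (minLevel (app u₁ u₂)) (minLevel s)
          (≤∞-minLevel-step st (≤⊓∞⇒≤ˡ (minLevel (app t r)) (minLevel s) n≤))
          (≤⊓∞⇒≤ʳ (minLevel (app t r)) (minLevel s) n≤)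
  ≤∞-minLevel-step {n = suc n} (right {t = var _} st) n≤ = ≤∞-minLevel-step st n≤
  ≤∞-minLevel-step {n = suc n} (right {t = app t r} {s = s} {u = u} st) n≤ =
    ⊓∞-glb (minLevel (app t r)) (minLevel u)
      (≤⊓∞⇒≤ˡ (minLevel (app t r)) _ n≤) (≤∞-minLevel-step st (≤⊓∞⇒≤ʳ (minLevel (app t r)) _ n≤))
  ≤∞-minLevel-step {n = suc n} (right {t = lam _} {s = var _} st) ()
  ≤∞-minLevel-step {n = suc n} (right {t = lam _} {s = lam _} st) ()
  ≤∞-minLevel-step {n = suc n} (right {t = lam t} {s = app s₁ s₂} st) n≤ with app-step-suc st
  ... | app {u₁} {u₂} = ⊓∞-glb (minLevel t) (minLevel (app u₁ u₂))
          (≤⊓∞⇒≤ˡ (minLevel t) (minLevel (app s₁ s₂)) n≤)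
          (≤∞-minLevel-step st (≤⊓∞⇒≤ʳ (minLevel t) (minLevel (app s₁ s₂)) n≤))

  step-sub : ∀ {t n t'} → t ⟶[ n ] t' → ∀ σ → (∀ i → Value (σ i)) → sub σ t ⟶[ n ] sub σ t'
  step-sub (root t s s-val) σ σ-val rewrite sub-[]₀ σ t s = root (sub (exts σ) t) (sub σ s) (value-sub σ-val s-val)
  step-sub (under-lam st) σ σ-val = under-lam (step-sub st (exts σ) (value-exts σ-val))
  step-sub (left-lam st) σ σ-val = left-lam (step-sub st (exts σ) (value-exts σ-val))
  step-sub (left {t = app _ _} app st) σ σ-val = left app (step-sub st σ σ-val)
  step-sub (right st) σ σ-val = right (step-sub st σ σ-val)

  step-notLam : ∀ {t n u w} → NotLam t → t ⟶[ n ] u → u ⟶[ n ] w → NotLam u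
  step-notLam {u = var _} _ _ _ = var
  step-notLam {u = app _ _} _ _ _ = app
  step-notLam {u = lam _} app t⟶u (under-lam _) with app-step-suc t⟶u
  ... | ()

  diamond : ∀ {t n u₁ u₂} → t ⟶[ n ] u₁ → t ⟶[ n ] u₂ → u₁ ≡ u₂ ⊎ Σ Term λ w → u₁ ⟶[ n ] w × u₂ ⟶[ n ] w
  diamond (root t s _) (root .t .s _) = inj₁ refl
  diamond (root t s s-val) (left-lam {u = t'} st) =
    inj₂ (t' [ s ]₀ , step-sub st (s ∷ₛ var) (value-∷ₛ s-val) , root t' s s-val)
  diamond (left-lam {u = t'} st) (root t s s-val) =
    inj₂ (t' [ s ]₀ , root t' s s-val , step-sub st (s ∷ₛ var) (value-∷ₛ s-val))
  diamond (root t (lam s) _) (right ())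
  diamond (right ()) (root t (lam s) _)
  diamond (root t s _) (left () st)
  diamond (left () st) (root t s _)
  diamond (under-lam st₁) (under-lam st₂) with diamond st₁ st₂
  ... | inj₁ refl = inj₁ refl
  ... | inj₂ (w , st₁' , st₂') = inj₂ (lam w , under-lam st₁' , under-lam st₂')
  diamond (left-lam st₁) (left-lam st₂) with diamond st₁ st₂
  ... | inj₁ refl = inj₁ refl
  ... | inj₂ (w , st₁' , st₂') = inj₂ (app (lam w) _ , left-lam st₁' , left-lam st₂')
  diamond (left-lam _) (left () _)
  diamond (left () _) (left-lam _)
  diamond (left-lam {u = u₁} st₁) (right {u = u₂} st₂) = inj₂ (app (lam u₁) u₂ , right st₂ , left-lam st₁)
  diamond (right {u = u₂} st₂) (left-lam {u = u₁} st₁) = inj₂ (app (lam u₁) u₂ , left-lam st₁ , right st₂)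
  diamond (left nl st₁) (left _ st₂) with diamond st₁ st₂
  ... | inj₁ refl = inj₁ refl
  ... | inj₂ (w , st₁' , st₂') =
    inj₂ (app w _ , left (step-notLam nl st₁ st₁') st₁' , left (step-notLam nl st₂ st₂') st₂')
  diamond (left {u = u₁} nl st₁) (right {u = u₂} st₂) = inj₂ (app u₁ u₂ , right st₂ , left nl st₁)
  diamond (right {u = u₂} st₂) (left {u = u₁} nl st₁) = inj₂ (app u₁ u₂ , left nl st₁ , right st₂)
  diamond (right st₁) (right st₂) with diamond st₁ st₂
  ... | inj₁ refl = inj₁ refl
  ... | inj₂ (w , st₁' , st₂') = inj₂ (app _ w , right st₁' , right st₂')

  infix 4 _⟶w_
  data _⟶w_ : Rel where
    w-root : ∀ t s → Value s → app (lam t) s ⟶w t [ s ]₀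
    w-left : ∀ {t t' s} → t ⟶w t' → app t s ⟶w app t' s
    w-right : ∀ {t s s'} → Value t → s ⟶w s' → app t s ⟶w app t s'

  ⟶w-ren : ∀ ρ {t t'} → t ⟶w t' → ren ρ t ⟶w ren ρ t'
  ⟶w-ren ρ (w-root t s s-val) rewrite ren-[]₀ ρ t s = w-root (ren (ext ρ) t) (ren ρ s) (value-ren ρ s-val)
  ⟶w-ren ρ (w-left st) = w-left (⟶w-ren ρ st)
  ⟶w-ren ρ (w-right t-val st) = w-right (value-ren ρ t-val) (⟶w-ren ρ st)

  ⟶w-sub : ∀ {σ} → (∀ n → Value (σ n)) → ∀ {t t'} → t ⟶w t' → sub σ t ⟶w sub σ t'
  ⟶w-sub {σ} σ-val (w-root t s s-val) rewrite sub-[]₀ σ t s =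
    w-root (sub (exts σ) t) (sub σ s) (value-sub σ-val s-val)
  ⟶w-sub σ-val (w-left st) = w-left (⟶w-sub σ-val st)
  ⟶w-sub σ-val (w-right t-val st) = w-right (value-sub σ-val t-val) (⟶w-sub σ-val st)

  open Standardisation _⟶w_ (λ σ → ∀ n → Value (σ n)) value-exts ⟶w-ren ⟶w-sub

  ⇝-value : ∀ {r v} → r ⇝ v → Value v → Σ Term λ v' → Star _⟶w_ r v' × Value v' × v' ⇝ v
  ⇝-value (⇝var hs) (var x) = var x , hs , var x , ⇝var ε
  ⇝-value (⇝lam {p = p} hs p⇝q) (lam _) = lam p , hs , lam p , ⇝lam ε p⇝q

  ⇝-step : ∀ {t u n u'} → t ⇝ u → u ⟶[ n ] u' → t ⇝ u'
  ⇝-step (⇝lam hs p) (under-lam st) = ⇝lam hs (⇝-step p st)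
  ⇝-step (⇝app hs p r) (left-lam st) = ⇝app hs (⇝-step p (under-lam st)) r
  ⇝-step (⇝app hs p r) (left _ st) = ⇝app hs (⇝-step p st) r
  ⇝-step (⇝app hs p r) (right st) = ⇝app hs p (⇝-step r st)
  ⇝-step (⇝app {r = s} hs (⇝lam {p = t} hs' p) r) (root _ _ s'-val) with ⇝-value r s'-val
  ... | v , s⟶w*v , v-val , v⇝s' =
    ⟶h*-⇝ (hs ◅◅ gmap (λ x → app x s) w-left hs' ◅◅ gmap (app (lam t)) (w-right (lam t)) s⟶w*v ◅◅
             w-root t v v-val ◅ ε)
          (⇝-[]₀ (value-∷ₛ v-val) p v⇝s')

  ⟶βv*⇒⇝ : ∀ {t u} → Star _→βv_ t u → t ⇝ u
  ⟶βv*⇒⇝ = go (⇝-refl _)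
    where
    go : ∀ {t m u} → t ⇝ m → Star _→βv_ m u → t ⇝ u
    go t⇝m ε = t⇝m
    go t⇝m ((c , r , r' , refl , refl , r↦r') ◅ steps) = go (⇝-step t⇝m (plug-step c r↦r')) steps

  open LeastLevel _↦βv_ levV _⟶[_]_ minLevel plug-step step-plug minLevel-∞≤ minLevel-step ≤∞-minLevel-step diamond

  ⟶w⇒⟶ℓℓ : ∀ {t t'} → t ⟶w t' → t ⟶ℓℓ t'
  ⟶w⇒⟶ℓℓ {t} st = 0 , level0 st , z≤∞ (minLevel t)
    where
    level0 : ∀ {t t'} → t ⟶w t' → t ⟶[ 0 ] t'
    level0 (w-root t s s-val) = root t s s-val
    level0 (w-left st@(w-root _ _ _)) = left app (level0 st)
    level0 (w-left st@(w-left _)) = left app (level0 st)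
    level0 (w-left st@(w-right _ _)) = left app (level0 st)
    level0 (w-right _ st) = right (level0 st)

  lam-⟶ℓℓ* : ∀ {p q} → Star _⟶ℓℓ_ p q → Star _⟶ℓℓ_ (lam p) (lam q)
  lam-⟶ℓℓ* = gmap lam λ {p} (n , st , n≤) → suc n , under-lam st , s≤∞suc∞ (minLevel p) n≤

  ⟶ℓℓ*-notLam : ∀ {p p'} → Star _⟶ℓℓ_ p p' → NotLam p' → NotLam p
  ⟶ℓℓ*-notLam {var x} _ _ = var
  ⟶ℓℓ*-notLam {app _ _} _ _ = app
  ⟶ℓℓ*-notLam {lam _} ε ()
  ⟶ℓℓ*-notLam {lam _} ((_ , under-lam _ , _) ◅ steps) nl with ⟶ℓℓ*-notLam steps nl
  ... | ()

  ⟶ℓℓ*-isApp : ∀ {r r'} → Star _⟶ℓℓ_ r r' → IsApp r' → IsApp r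
  ⟶ℓℓ*-isApp {app _ _} _ _ = app
  ⟶ℓℓ*-isApp {var _} ε ()
  ⟶ℓℓ*-isApp {var _} ((_ , () , _) ◅ _) _
  ⟶ℓℓ*-isApp {lam _} ε ()
  ⟶ℓℓ*-isApp {lam _} ((_ , under-lam _ , _) ◅ steps) ia with ⟶ℓℓ*-isApp steps ia
  ... | ()

  ⟶ℓℓ*-notRedex : ∀ {p p' r r'} → Star _⟶ℓℓ_ p p' → Star _⟶ℓℓ_ r r' → NotRedex p' r' → NotRedex p r
  ⟶ℓℓ*-notRedex ps rs (inj₁ nl) = inj₁ (⟶ℓℓ*-notLam ps nl)
  ⟶ℓℓ*-notRedex ps rs (inj₂ ia) = inj₂ (⟶ℓℓ*-isApp rs ia)

  ≤∞-minLevel-app : ∀ {p r n} → NotRedex p r → n ≤∞ minLevelₗ p → n ≤∞ minLevel r → n ≤∞ minLevel (app p r)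
  ≤∞-minLevel-app {p} {r} nr n≤p n≤r rewrite minLevel-app nr = ⊓∞-glb (minLevelₗ p) (minLevel r) n≤p n≤r

  ⟶ℓℓ-left : ∀ {p p'} r → p ⟶ℓℓ p' → Σ ℕ λ j → app p r ⟶[ j ] app p' r × j ≤∞ minLevelₗ p
  ⟶ℓℓ-left {lam t} r (suc i , under-lam st , si≤) = i , left-lam st , s≤∞suc∞⁻¹ (minLevel t) si≤
  ⟶ℓℓ-left {app _ _} r (i , st , i≤) = i , left app st , i≤

  minLevelₗ-irreducible : ∀ p → Irreducible p → minLevelₗ p ≡ ∞
  minLevelₗ-irreducible (var x) _ = refl
  minLevelₗ-irreducible (lam t) irr = minLevel-irreducible t λ n u st → irr (suc n) (lam u) (under-lam st)
  minLevelₗ-irreducible (app t s) irr = minLevel-irreducible (app t s) irr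

  -- As for call-by-name, the side whose next step has the lower level goes first (left on ties).
  app-⟶ℓℓ* : ∀ {p p' r r'} → Star _⟶ℓℓ_ p p' → Star _⟶ℓℓ_ r r' → Irreducible p' → Irreducible r' → NotRedex p' r' →
    Star _⟶ℓℓ_ (app p r) (app p' r')
  app-⟶ℓℓ* ε ε _ _ _ = ε
  app-⟶ℓℓ* {p} {r = r} ε rs@((k , st , k≤) ◅ rs') irr-p irr-r nr =
    (k , right st , ≤∞-minLevel-app {p} {r} (⟶ℓℓ*-notRedex ε rs nr) (≤∞-∞ k (minLevelₗ-irreducible p irr-p)) k≤)
    ◅ app-⟶ℓℓ* ε rs' irr-p irr-r nr
  app-⟶ℓℓ* {p} {r = r} ps@(s ◅ ps') ε irr-p irr-r nr =
    let (j , st , j≤) = ⟶ℓℓ-left r s in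
    (j , st , ≤∞-minLevel-app {p} {r} (⟶ℓℓ*-notRedex ps ε nr) j≤ (≤∞-∞ j (minLevel-irreducible r irr-r)))
    ◅ app-⟶ℓℓ* ps' ε irr-p irr-r nr
  app-⟶ℓℓ* {p} {r = r} ps@(s ◅ ps') rs@((k , st' , k≤) ◅ rs') irr-p irr-r nr =
    let (j , st , j≤) = ⟶ℓℓ-left r s
        nr-now = ⟶ℓℓ*-notRedex ps rs nr
    in [ (λ j≤k → (j , st , ≤∞-minLevel-app {p} {r} nr-now j≤ (≤-≤∞-trans (minLevel r) j≤k k≤))
                  ◅ app-⟶ℓℓ* ps' rs irr-p irr-r nr)
       , (λ k<j → (k , right st' , ≤∞-minLevel-app {p} {r} nr-now (≤-≤∞-trans (minLevelₗ p) (<⇒≤ k<j) j≤) k≤)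
                  ◅ app-⟶ℓℓ* ps rs' irr-p irr-r nr)
       ]′ (≤-<-connex j k)

  irreducible-app-notRedex : ∀ {p r} → Irreducible (app p r) → NotRedex p r
  irreducible-app-notRedex {var _} _ = inj₁ var
  irreducible-app-notRedex {app _ _} _ = inj₁ app
  irreducible-app-notRedex {lam _} {app _ _} _ = inj₂ app
  irreducible-app-notRedex {lam t} {var y} irr = ⊥-elim (irr 0 (t [ var y ]₀) (root t (var y) (var y)))
  irreducible-app-notRedex {lam t} {lam s} irr = ⊥-elim (irr 0 (t [ lam s ]₀) (root t (lam s) (lam s)))

  app-step-left : ∀ {p p'} r {n} → p ⟶[ n ] p' → Σ ℕ λ m → app p r ⟶[ m ] app p' r
  app-step-left r (under-lam st) = _ , left-lam st
  app-step-left r st@(root _ _ _) = _ , left app st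
  app-step-left r st@(left-lam _) = _ , left app st
  app-step-left r st@(left _ _) = _ , left app st
  app-step-left r st@(right _) = _ , left app st

  ⇝⇒⟶ℓℓ* : ∀ {t u} → t ⇝ u → Irreducible u → Star _⟶ℓℓ_ t u
  ⇝⇒⟶ℓℓ* (⇝var hs) _ = map ⟶w⇒⟶ℓℓ hs
  ⇝⇒⟶ℓℓ* (⇝lam hs p) irr =
    map ⟶w⇒⟶ℓℓ hs ◅◅ lam-⟶ℓℓ* (⇝⇒⟶ℓℓ* p λ n u st → irr (suc n) (lam u) (under-lam st))
  ⇝⇒⟶ℓℓ* (⇝app {p' = p'} {r' = r'} hs p r) irr =
    map ⟶w⇒⟶ℓℓ hs ◅◅ app-⟶ℓℓ* (⇝⇒⟶ℓℓ* p irr-p') (⇝⇒⟶ℓℓ* r irr-r') irr-p' irr-r' (irreducible-app-notRedex irr)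
    where
    irr-p' : Irreducible p'
    irr-p' n u st = let (m , st') = app-step-left r' st in irr m (app u r') st'
    irr-r' : Irreducible r'
    irr-r' n u st = irr n (app p' u) (right st)

  normalizing : NormalizingStrategy _→llβv_ _→βv_
  normalizing = normalizingStrategy λ t⟶*u irr → ⇝⇒⟶ℓℓ* (⟶βv*⇒⇝ t⟶*u) irr

theorem4 : NormalizingStrategy _→llβ_ _→β_ × NormalizingStrategy _→llβv_ _→βv_
theorem4 = CallByName.normalizing , CallByValue.normalizing
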